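{- Let $n$ be a positive integer and let ${\mathrm T}_m=\binom{m+1}{2}$ denote the $m$th triangular number. Then $${\mathrm F}({\mathrm T}_n,{\mathrm T}_{n+1},{\mathrm T}_{n+2})=\begin{cases} \frac{3n^3+6n^2-3n-10}{4}, & \text{if $n$ is odd;}\\[3pt] \frac{3n^3+9n^2+6n-4}{4}, & \text{if $n$ is even.}\end{cases}$$ Equivalently, $${\mathrm F}({\mathrm T}_n,{\mathrm T}_{n+1},{\mathrm T}_{n+2})=\left\lfloor \frac{n}{2}\right\rfloor\big({\mathrm T}_n+{\mathrm T}_{n+1}+{\mathrm T}_{n+2}-1\big)-1.$$
   Context: For relatively prime positive integers $a_1,\ldots,a_k$, the Frobenius number ${\mathrm F}(a_1,\ldots,a_k)$ is the largest integer that is not representable as a non-negative integer linear combination of $a_1,\ldots,a_k$ (with the convention that it equals $-1$ when every non-negative integer is representable, e.g. when some $a_i=1$). The numbers ${\mathrm T}_n,{\mathrm T}_{n+1},{\mathrm T}_{n+2}$ are relatively prime. -}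

module Defs where

open import Data.Nat using (ℕ; _+_; _*_; _<_)
open import Data.Nat.Combinatorics using (_C_)
open import Data.Integer as ℤ using (ℤ; +_)
open import Data.Product using (∃; ∃-syntax; _×_)
open import Relation.Binary.PropositionalEquality using (_≡_)
open import Relation.Nullary using (¬_)

T : ℕ → ℕ
T m = (m + 1) C 2


Representable3 : ℕ → ℕ → ℕ → ℕ → Set
Representable3 a b c m = ∃[ x ] ∃[ y ] ∃[ z ] (x * a + y * b + z * c ≡ m)

Representableℤ : ℕ → ℕ → ℕ → ℤ → Set
Representableℤ a b c k = ∃[ m ] ((k ≡ + m) × Representable3 a b c m)

-- f is the Frobenius number F(a,b,c): the largest integer not representable
-- (negative integers are never representable, so f = -1 when all of ℕ is).
IsFrobenius3 : ℕ → ℕ → ℕ → ℤ → Set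
IsFrobenius3 a b c f =
  (¬ Representableℤ a b c f) × (∀ (k : ℤ) → f ℤ.< k → Representableℤ a b c k)

{-# OPTIONS --safe #-}
-- Two of T n, T (n+1), T (n+2) share a factor d: for n = 2k, T n = d k and T (n+1) = d (k+1)
-- with d = 2k+1; for n = 2k+1, T (n+1) = d (k+1) and T (n+2) = d (k+2) with d = 2k+3. In both
-- cases the third generator c is ≡ 1 (mod d) and a multiple of one of the two consecutive
-- cofactors m, m+1, so Johnson's reduction F(d a, d b, c) = d F(a, b, c) + (d - 1) c brings the
-- problem down to the pair m, m+1. Its Frobenius number m² - m - 1 is the same reduction applied
-- to the trivial semigroup generated by 1, with d = m and c = m + 1. All of this is cleanest for
-- the conductor F + 1, which Johnson's formula sends to d (g + (d - 1) q) when c = 1 + q d.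
module Submission where

open import Defs
open import Data.Nat using (ℕ; suc; _/_; _*_; _+_; _∸_)
open import Data.Nat using (_%_)
open import Data.Integer as ℤ using (ℤ; +_; -_)
open import Data.Product using (_×_)
open import Relation.Binary.PropositionalEquality using (_≡_)

open import Data.Nat using (zero; _≤_; _<_)
open import Data.Nat.Properties
open import Data.Nat.DivMod using (result; _divMod_; m≡m%n+[m/n]*n; m*n/n≡m; +-distrib-/-∣ʳ)
open import Data.Nat.Divisibility using (_∣_; ∣m+n∣m⇒∣n; ∣⇒≤; m∣m*n; n∣m*n)
open import Data.Nat.Combinatorics using (_C_; nC1≡n; nCk+nC[k+1]≡[n+1]C[k+1])
open import Data.Nat.Tactic.RingSolver using (solve)
import Data.Fin as Fin
open import Data.Fin.Properties using (toℕ<n)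
import Data.Integer.Properties as ℤP
import Data.Integer.Tactic.RingSolver as ℤ-Solver
open import Data.List using (_∷_; [])
open import Data.Product using (_,_)
open import Relation.Nullary using (¬_; contradiction)
open import Relation.Binary.Definitions using (tri<; tri≈; tri>)
open import Relation.Binary.PropositionalEquality using (refl; sym; trans; cong; cong₂; subst; module ≡-Reasoning)

representable-swap : ∀ {a b c N} → Representable3 a b c N → Representable3 a c b N
representable-swap {a} {b} {c} {N} (x , y , z , rep) = x , z , y , (begin
  x * a + z * c + y * b ≡⟨ solve (x ∷ y ∷ z ∷ a ∷ b ∷ c ∷ []) ⟩
  x * a + y * b + z * c ≡⟨ rep ⟩
  N                     ∎)
  where open ≡-Reasoning

representable-rotate : ∀ {a b c N} → Representable3 a b c N → Representable3 b c a N
representable-rotate {a} {b} {c} {N} (x , y , z , rep) = y , z , x , (begin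
  y * b + z * c + x * a ≡⟨ solve (x ∷ y ∷ z ∷ a ∷ b ∷ c ∷ []) ⟩
  x * a + y * b + z * c ≡⟨ rep ⟩
  N                     ∎)
  where open ≡-Reasoning

representable-extend : ∀ {a b c N} → Representable3 a b 0 N → Representable3 a b c N
representable-extend {a} {b} (x , y , z , rep) =
  x , y , 0 , trans (cong (λ t → x * a + y * b + t) (sym (*-zeroʳ z))) rep

representable-absorb : ∀ {a b c N} → Representable3 a b 0 c → Representable3 a b c N →
                       Representable3 a b 0 N
representable-absorb {a} {b} {c} {N} (x′ , y′ , z′ , repc) (x , y , z , rep) =
  x + z * x′ , y + z * y′ , 0 , (begin
    (x + z * x′) * a + (y + z * y′) * b + 0 * 0   ≡⟨ solve (x ∷ y ∷ z ∷ x′ ∷ y′ ∷ a ∷ b ∷ []) ⟩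
    x * a + y * b + z * (x′ * a + y′ * b + 0)    ≡⟨ cong (λ t → x * a + y * b + z * (x′ * a + y′ * b + t)) (sym (*-zeroʳ z′)) ⟩
    x * a + y * b + z * (x′ * a + y′ * b + z′ * 0) ≡⟨ cong (λ t → x * a + y * b + z * t) repc ⟩
    x * a + y * b + z * c                        ≡⟨ rep ⟩
    N                                            ∎)
  where open ≡-Reasoning

IsConductor3 : ℕ → ℕ → ℕ → ℕ → Set
IsConductor3 a b c g =
  (∀ h → suc h ≡ g → ¬ Representable3 a b c h) × (∀ m → Representable3 a b c (g + m))

isConductor3-cong : ∀ {a a′ b b′ c c′ g g′} → a ≡ a′ → b ≡ b′ → c ≡ c′ → g ≡ g′ →
                    IsConductor3 a b c g → IsConductor3 a′ b′ c′ g′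
isConductor3-cong refl refl refl refl isC = isC

isConductor3-transfer : ∀ {a b c a′ b′ c′ g} →
  (∀ {N} → Representable3 a b c N → Representable3 a′ b′ c′ N) →
  (∀ {N} → Representable3 a′ b′ c′ N → Representable3 a b c N) →
  IsConductor3 a b c g → IsConductor3 a′ b′ c′ g
isConductor3-transfer to from (gap , tail) = (λ h 1+h≡g rep → gap h 1+h≡g (from rep)) , (λ m → to (tail m))

isConductor3⇒isFrobenius3 : ∀ {a b c g} → IsConductor3 a b c g → IsFrobenius3 a b c (+ g ℤ.- + 1)
isConductor3⇒isFrobenius3 {a} {b} {c} {zero} (_ , tail) = (λ { (_ , () , _) }) , above
  where
  above : ∀ k → ℤ.-[1+ 0 ] ℤ.< k → Representableℤ a b c k
  above (+ m)      _             = m , refl , tail m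
  above ℤ.-[1+ _ ] (ℤ.-<- ())
isConductor3⇒isFrobenius3 {a} {b} {c} {suc g} (gap , tail) = below , above
  where
  below : ¬ Representableℤ a b c (+ g)
  below (_ , refl , rep) = gap g refl rep
  above : ∀ k → + g ℤ.< k → Representableℤ a b c k
  above (+ m) (ℤ.+<+ g<m) with m≤n⇒∃[o]m+o≡n g<m
  ... | o , refl = _ , refl , tail o

isFrobenius3-unique : ∀ {a b c f f′} → IsFrobenius3 a b c f → IsFrobenius3 a b c f′ → f′ ≡ f
isFrobenius3-unique {f = f} {f′} (gap , tail) (gap′ , tail′) with ℤP.<-cmp f f′
... | tri< f<f′ _ _ = contradiction (tail f′ f<f′) gap′
... | tri≈ _ f≡f′ _ = sym f≡f′
... | tri> _ _ f′<f = contradiction (tail′ f f′<f) gap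

isConductor3-unit : ∀ c → IsConductor3 1 0 c 0
isConductor3-unit c = (λ _ ()) , λ m → m , 0 , 0 , solve (m ∷ c ∷ [])

remainder+1≡divisor : ∀ {d X Y r} → r < d → d * X + suc r ≡ d * Y → suc r ≡ d
remainder+1≡divisor {d} {X} {Y} {r} r<d eq = ≤-antisym r<d (∣⇒≤ d∣1+r)
  where
  d∣1+r : d ∣ suc r
  d∣1+r = ∣m+n∣m⇒∣n (subst (d ∣_) (sym eq) (m∣m*n Y)) (m∣m*n X)

-- Johnson's reduction with d = 1 + e and c = 1 + q d: since c ≡ 1 (mod d), a representation
-- of N uses the generator c a number of times ≡ N (mod d).
isConductor3-scale : ∀ {a b g} e q → IsConductor3 a b (suc (q * suc e)) g →
  IsConductor3 (suc e * a) (suc e * b) (suc (q * suc e)) (suc e * (g + e * q))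
isConductor3-scale {a} {b} {g} e q (gap , tail) = gap′ , tail′
  where
  open ≡-Reasoning

  tail′ : ∀ N → Representable3 (suc e * a) (suc e * b) (suc (q * suc e)) (suc e * (g + e * q) + N)
  tail′ N with N divMod suc e
  ... | result Q r refl with Fin.toℕ r | toℕ<n r
  ...   | r′ | r′<d with m≤n⇒∃[o]m+o≡n (≤-pred r′<d)
  ...     | s , r+s≡e with tail (Q + s * q)
  ...       | x , y , z , rep = x , y , r′ + suc e * z , (begin
    x * (suc e * a) + y * (suc e * b) + (r′ + suc e * z) * suc (q * suc e)
      ≡⟨ solve (x ∷ y ∷ z ∷ a ∷ b ∷ r′ ∷ q ∷ e ∷ []) ⟩
    suc e * (x * a + y * b + z * suc (q * suc e)) + r′ * suc (q * suc e)
      ≡⟨ cong (λ t → suc e * t + r′ * suc (q * suc e)) rep ⟩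
    suc e * (g + (Q + s * q)) + r′ * suc (q * suc e)
      ≡⟨ solve (g ∷ Q ∷ s ∷ r′ ∷ q ∷ e ∷ []) ⟩
    suc e * (g + (r′ + s) * q) + (r′ + Q * suc e)
      ≡⟨ cong (λ t → suc e * (g + t * q) + (r′ + Q * suc e)) r+s≡e ⟩
    suc e * (g + e * q) + (r′ + Q * suc e) ∎)

  gap′ : ∀ h → suc h ≡ suc e * (g + e * q) → ¬ Representable3 (suc e * a) (suc e * b) (suc (q * suc e)) h
  gap′ h 1+h≡ (x , y , z , rep) with z divMod suc e
  ... | result w r refl with Fin.toℕ r | toℕ<n r
  ...   | r′ | r′<d = gap (x * a + y * b + w * suc (q * suc e)) 1+h′≡g (x , y , w , refl)
    where
    h′ : ℕ
    h′ = x * a + y * b + w * suc (q * suc e)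
    h≡ : suc e * (h′ + r′ * q) + r′ ≡ h
    h≡ = begin
      suc e * (x * a + y * b + w * suc (q * suc e) + r′ * q) + r′
        ≡⟨ solve (x ∷ y ∷ w ∷ a ∷ b ∷ r′ ∷ q ∷ e ∷ []) ⟩
      x * (suc e * a) + y * (suc e * b) + (r′ + w * suc e) * suc (q * suc e)
        ≡⟨ rep ⟩
      h ∎
    h+1≡ : suc e * (h′ + r′ * q) + suc r′ ≡ suc e * (g + e * q)
    h+1≡ = trans (+-suc _ r′) (trans (cong suc h≡) 1+h≡)
    1+r≡d : suc r′ ≡ suc e
    1+r≡d = remainder+1≡divisor r′<d h+1≡
    r≡e : r′ ≡ e
    r≡e = suc-injective 1+r≡d
    multiple : suc e * suc (h′ + r′ * q) ≡ suc e * (g + e * q)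
    multiple = begin
      suc e * suc (h′ + r′ * q)      ≡⟨ *-suc (suc e) _ ⟩
      suc e + suc e * (h′ + r′ * q)  ≡⟨ +-comm (suc e) _ ⟩
      suc e * (h′ + r′ * q) + suc e  ≡⟨ cong (λ t → suc e * (h′ + r′ * q) + t) (sym 1+r≡d) ⟩
      suc e * (h′ + r′ * q) + suc r′ ≡⟨ h+1≡ ⟩
      suc e * (g + e * q)            ∎
    1+h′≡g : suc h′ ≡ g
    1+h′≡g = +-cancelʳ-≡ (e * q) (suc h′) g (begin
      suc h′ + e * q     ≡⟨ cong (λ t → suc h′ + t * q) (sym r≡e) ⟩
      suc (h′ + r′ * q)  ≡⟨ *-cancelˡ-≡ _ _ (suc e) multiple ⟩
      g + e * q          ∎)

isConductor3-consecutive : ∀ e → IsConductor3 (suc e) (suc (suc e)) 0 (suc e * e)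
isConductor3-consecutive e =
  isConductor3-transfer representable-swap representable-swap
    (isConductor3-cong (*-identityʳ (suc e)) (*-zeroʳ (suc e)) (cong suc (*-identityˡ (suc e)))
                       (cong (suc e *_) (*-identityʳ e))
      (isConductor3-scale e 1 (isConductor3-unit (suc (1 * suc e)))))

isConductor3-add-generator : ∀ {a b c g} → Representable3 a b 0 c →
                             IsConductor3 a b 0 g → IsConductor3 a b c g
isConductor3-add-generator repc = isConductor3-transfer representable-extend (representable-absorb repc)

T-suc : ∀ m → T (suc m) ≡ suc m + T m
T-suc m = begin
  T (suc m)                 ≡⟨ nCk+nC[k+1]≡[n+1]C[k+1] (m + 1) 1 ⟨
  (m + 1) C 1 + (m + 1) C 2 ≡⟨ cong (_+ T m) (trans (nC1≡n (m + 1)) (+-comm m 1)) ⟩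
  suc m + T m               ∎
  where open ≡-Reasoning

double-T : ∀ m → 2 * T m ≡ m * suc m
double-T zero    = refl
double-T (suc m) = begin
  2 * T (suc m)          ≡⟨ cong (2 *_) (T-suc m) ⟩
  2 * (suc m + T m)      ≡⟨ *-distribˡ-+ 2 (suc m) (T m) ⟩
  2 * suc m + 2 * T m    ≡⟨ cong (λ t → 2 * suc m + t) (double-T m) ⟩
  2 * suc m + m * suc m  ≡⟨ solve (m ∷ []) ⟩
  suc m * suc (suc m)    ∎
  where open ≡-Reasoning

T≡half : ∀ m x → m * suc m ≡ 2 * x → T m ≡ x
T≡half m x eq = *-cancelˡ-≡ (T m) x 2 (trans (double-T m) eq)

triangularConductor : ℕ → ℕ
triangularConductor n = (n / 2) * (T n + T (suc n) + T (suc (suc n)) ∸ 1)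

triangular-sum : ∀ n → 2 * (T n + T (suc n) + T (suc (suc n)) ∸ 1) ≡ 3 * ((1 + n) * (2 + n))
triangular-sum n = begin
  2 * (T n + T (suc n) + T (suc (suc n)) ∸ 1) ≡⟨ *-distribˡ-∸ 2 (T n + T (suc n) + T (suc (suc n))) 1 ⟩
  2 * (T n + T (suc n) + T (suc (suc n))) ∸ 2 ≡⟨ cong (_∸ 2) double-sum ⟩
  3 * ((1 + n) * (2 + n)) + 2 ∸ 2             ≡⟨ m+n∸n≡m (3 * ((1 + n) * (2 + n))) 2 ⟩
  3 * ((1 + n) * (2 + n))                     ∎
  where
  open ≡-Reasoning
  double-sum : 2 * (T n + T (suc n) + T (suc (suc n))) ≡ 3 * ((1 + n) * (2 + n)) + 2
  double-sum = begin
    2 * (T n + T (suc n) + T (suc (suc n)))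
      ≡⟨ *-distribˡ-+ 2 (T n + T (suc n)) _ ⟩
    2 * (T n + T (suc n)) + 2 * T (suc (suc n))
      ≡⟨ cong (λ t → t + 2 * T (suc (suc n))) (*-distribˡ-+ 2 (T n) _) ⟩
    2 * T n + 2 * T (suc n) + 2 * T (suc (suc n))
      ≡⟨ cong₂ _+_ (cong₂ _+_ (double-T n) (double-T (suc n))) (double-T (suc (suc n))) ⟩
    n * suc n + suc n * suc (suc n) + suc (suc n) * suc (suc (suc n))
      ≡⟨ solve (n ∷ []) ⟩
    3 * ((1 + n) * (2 + n)) + 2
      ∎

four-triangularConductor : ∀ n → 4 * triangularConductor n ≡ n / 2 * 2 * (3 * ((1 + n) * (2 + n)))
four-triangularConductor n = begin
  4 * (n / 2 * S)        ≡⟨ [m*n]*[o*p]≡[m*o]*[n*p] 2 2 (n / 2) S ⟩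
  2 * (n / 2) * (2 * S)  ≡⟨ cong₂ _*_ (*-comm 2 (n / 2)) (triangular-sum n) ⟩
  n / 2 * 2 * (3 * ((1 + n) * (2 + n))) ∎
  where
  open ≡-Reasoning
  S : ℕ
  S = T n + T (suc n) + T (suc (suc n)) ∸ 1

triangularConductor-unique : ∀ n {h V} → n / 2 ≡ h → 4 * V ≡ h * 2 * (3 * ((1 + n) * (2 + n))) →
                             V ≡ triangularConductor n
triangularConductor-unique n {h} {V} n/2≡h eq = sym (*-cancelˡ-≡ _ V 4 (begin
  4 * triangularConductor n               ≡⟨ four-triangularConductor n ⟩
  n / 2 * 2 * (3 * ((1 + n) * (2 + n)))   ≡⟨ cong (λ t → t * 2 * (3 * ((1 + n) * (2 + n)))) n/2≡h ⟩
  h * 2 * (3 * ((1 + n) * (2 + n)))       ≡⟨ eq ⟨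
  4 * V                                   ∎))
  where open ≡-Reasoning

isConductor3-T-even : ∀ j → IsConductor3 (T (suc j * 2)) (T (suc (suc j * 2))) (T (2 + suc j * 2))
                                         (triangularConductor (suc j * 2))
isConductor3-T-even j =
  isConductor3-cong
    (sym (T≡half (suc j * 2) (suc (suc j * 2) * suc j) (solve (j ∷ []))))
    (sym (T≡half (suc (suc j * 2)) (suc (suc j * 2) * suc (suc j)) (solve (j ∷ []))))
    (sym (T≡half (2 + suc j * 2) (suc ((3 + j) * suc (suc j * 2))) (solve (j ∷ []))))
    (triangularConductor-unique (suc j * 2) (m*n/n≡m (suc j) 2) value)
    (isConductor3-scale (suc j * 2) (3 + j)
      (isConductor3-add-generator c-rep (isConductor3-consecutive j)))
  where
  c-rep : Representable3 (suc j) (suc (suc j)) 0 (suc ((3 + j) * suc (suc j * 2)))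
  c-rep = 0 , 3 + suc j * 2 , 0 , solve (j ∷ [])
  value : 4 * (suc (suc j * 2) * (suc j * j + suc j * 2 * (3 + j)))
        ≡ suc j * 2 * (3 * ((1 + suc j * 2) * (2 + suc j * 2)))
  value = solve (j ∷ [])

isConductor3-T-odd : ∀ k → IsConductor3 (T (suc (k * 2))) (T (2 + k * 2)) (T (3 + k * 2))
                                        (triangularConductor (suc (k * 2)))
isConductor3-T-odd k =
  isConductor3-cong
    (sym (T≡half (suc (k * 2)) (suc (k * (3 + k * 2))) (solve (k ∷ []))))
    (sym (T≡half (2 + k * 2) ((3 + k * 2) * suc k) (solve (k ∷ []))))
    (sym (T≡half (3 + k * 2) ((3 + k * 2) * (2 + k)) (solve (k ∷ []))))
    (triangularConductor-unique (suc (k * 2)) half value)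
    (isConductor3-transfer (λ rep → representable-rotate (representable-rotate rep)) representable-rotate
      (isConductor3-scale (2 + k * 2) k
        (isConductor3-add-generator c-rep (isConductor3-consecutive k))))
  where
  c-rep : Representable3 (suc k) (suc (suc k)) 0 (suc (k * (3 + k * 2)))
  c-rep = 1 + k * 2 , 0 , 0 , solve (k ∷ [])
  half : suc (k * 2) / 2 ≡ k
  half = trans (+-distrib-/-∣ʳ 1 {d = 2} (n∣m*n k)) (cong (λ t → 1 / 2 + t) (m*n/n≡m k 2))
  value : 4 * ((3 + k * 2) * (suc k * k + (2 + k * 2) * k))
        ≡ k * 2 * (3 * ((1 + suc (k * 2)) * (2 + suc (k * 2))))
  value = solve (k ∷ [])

isConductor3-T : ∀ n → 1 ≤ n → IsConductor3 (T n) (T (suc n)) (T (suc (suc n))) (triangularConductor n)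
isConductor3-T n 1≤n with n divMod 2
... | result zero    Fin.zero           refl = contradiction 1≤n λ ()
... | result (suc j) Fin.zero           refl = isConductor3-T-even j
... | result k       (Fin.suc Fin.zero) refl = isConductor3-T-odd k

four-times-pred : ∀ G P → 4 * G ≡ P → + 4 ℤ.* (+ G ℤ.- + 1) ≡ + P ℤ.- + 4
four-times-pred G P 4G≡P = begin
  + 4 ℤ.* (+ G ℤ.- + 1)     ≡⟨ ℤP.*-distribˡ-+ (+ 4) (+ G) (- + 1) ⟩
  + 4 ℤ.* + G ℤ.- + 4       ≡⟨ cong (ℤ._- + 4) (ℤP.pos-* 4 G) ⟨
  + (4 * G) ℤ.- + 4         ≡⟨ cong (λ t → + t ℤ.- + 4) 4G≡P ⟩
  + P ℤ.- + 4               ∎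
  where open ≡-Reasoning

pos-*³ : ∀ a b c d → + (a * (b * (c * d))) ≡ + a ℤ.* (+ b ℤ.* (+ c ℤ.* + d))
pos-*³ a b c d = trans (ℤP.pos-* a _) (cong (+ a ℤ.*_) (trans (ℤP.pos-* b _) (cong (+ b ℤ.*_) (ℤP.pos-* c d))))

closed-form-even : ∀ {n m} G → n ≡ m → 4 * G ≡ m * (3 * ((1 + n) * (2 + n))) →
  + 4 ℤ.* (+ G ℤ.- + 1) ≡ + 3 ℤ.* (+ n) ℤ.^ 3 ℤ.+ + 9 ℤ.* (+ n) ℤ.^ 2 ℤ.+ + 6 ℤ.* + n ℤ.- + 4
closed-form-even {n} G refl 4G≡ = begin
  + 4 ℤ.* (+ G ℤ.- + 1)                       ≡⟨ four-times-pred G _ 4G≡ ⟩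
  + (n * (3 * ((1 + n) * (2 + n)))) ℤ.- + 4   ≡⟨ cong (ℤ._- + 4) (pos-*³ n 3 (1 + n) (2 + n)) ⟩
  + n ℤ.* (+ 3 ℤ.* (+ (1 + n) ℤ.* + (2 + n))) ℤ.- + 4 ≡⟨ cubic (+ n) ⟩
  + 3 ℤ.* (+ n) ℤ.^ 3 ℤ.+ + 9 ℤ.* (+ n) ℤ.^ 2 ℤ.+ + 6 ℤ.* + n ℤ.- + 4 ∎
  where
  open ≡-Reasoning
  -- ℤ._^_ is unfolded by hand: the ring solver does not recognise it.
  cubic : ∀ N → N ℤ.* (+ 3 ℤ.* ((+ 1 ℤ.+ N) ℤ.* (+ 2 ℤ.+ N))) ℤ.- + 4
              ≡ + 3 ℤ.* (N ℤ.* (N ℤ.* (N ℤ.* + 1))) ℤ.+ + 9 ℤ.* (N ℤ.* (N ℤ.* + 1)) ℤ.+ + 6 ℤ.* N ℤ.- + 4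
  cubic = ℤ-Solver.solve-∀

closed-form-odd : ∀ {n m} G → n ≡ suc m → 4 * G ≡ m * (3 * ((1 + n) * (2 + n))) →
  + 4 ℤ.* (+ G ℤ.- + 1) ≡ + 3 ℤ.* (+ n) ℤ.^ 3 ℤ.+ + 6 ℤ.* (+ n) ℤ.^ 2 ℤ.- + 3 ℤ.* + n ℤ.- + 10
closed-form-odd {m = m} G refl 4G≡ = begin
  + 4 ℤ.* (+ G ℤ.- + 1)                         ≡⟨ four-times-pred G _ 4G≡ ⟩
  + (m * (3 * ((2 + m) * (3 + m)))) ℤ.- + 4     ≡⟨ cong (ℤ._- + 4) (pos-*³ m 3 (2 + m) (3 + m)) ⟩
  + m ℤ.* (+ 3 ℤ.* (+ (2 + m) ℤ.* + (3 + m))) ℤ.- + 4 ≡⟨ cubic (+ m) ⟩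
  + 3 ℤ.* (+ suc m) ℤ.^ 3 ℤ.+ + 6 ℤ.* (+ suc m) ℤ.^ 2 ℤ.- + 3 ℤ.* + suc m ℤ.- + 10 ∎
  where
  open ≡-Reasoning
  cubic : ∀ M → let N = + 1 ℤ.+ M in M ℤ.* (+ 3 ℤ.* ((+ 2 ℤ.+ M) ℤ.* (+ 3 ℤ.+ M))) ℤ.- + 4
              ≡ + 3 ℤ.* (N ℤ.* (N ℤ.* (N ℤ.* + 1))) ℤ.+ + 6 ℤ.* (N ℤ.* (N ℤ.* + 1)) ℤ.- + 3 ℤ.* N ℤ.- + 10
  cubic = ℤ-Solver.solve-∀

halve : ∀ n {r} → n % 2 ≡ r → n ≡ r + n / 2 * 2
halve n refl = m≡m%n+[m/n]*n n 2

proposition6 : (n : ℕ) → 1 Data.Nat.≤ n →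
    IsFrobenius3 (T n) (T (suc n)) (T (suc (suc n)))
      (+ ((n / 2) * (T n + T (suc n) + T (suc (suc n)) ∸ 1)) ℤ.- + 1)
    × (n % 2 ≡ 1 → ∀ (F : ℤ) → IsFrobenius3 (T n) (T (suc n)) (T (suc (suc n))) F →
        + 4 ℤ.* F ≡ + 3 ℤ.* (+ n) ℤ.^ 3 ℤ.+ + 6 ℤ.* (+ n) ℤ.^ 2 ℤ.- + 3 ℤ.* + n ℤ.- + 10)
    × (n % 2 ≡ 0 → ∀ (F : ℤ) → IsFrobenius3 (T n) (T (suc n)) (T (suc (suc n))) F →
        + 4 ℤ.* F ≡ + 3 ℤ.* (+ n) ℤ.^ 3 ℤ.+ + 9 ℤ.* (+ n) ℤ.^ 2 ℤ.+ + 6 ℤ.* + n ℤ.- + 4)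
proposition6 n 1≤n =
    frobenius
  , (λ n%2≡1 F isF → trans (times-four isF)
      (closed-form-odd (triangularConductor n) (halve n n%2≡1) (four-triangularConductor n)))
  , (λ n%2≡0 F isF → trans (times-four isF)
      (closed-form-even (triangularConductor n) (halve n n%2≡0) (four-triangularConductor n)))
  where
  frobenius : IsFrobenius3 (T n) (T (suc n)) (T (suc (suc n))) (+ triangularConductor n ℤ.- + 1)
  frobenius = isConductor3⇒isFrobenius3 (isConductor3-T n 1≤n)

  times-four : ∀ {F} → IsFrobenius3 (T n) (T (suc n)) (T (suc (suc n))) F →
               + 4 ℤ.* F ≡ + 4 ℤ.* (+ triangularConductor n ℤ.- + 1)
  times-four isF = cong (+ 4 ℤ.*_) (isFrobenius3-unique frobenius isF)
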